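{- Let $G$ be a finite $\Delta$-regular graph and let $r$ be a positive integer with $r\le\Delta$. Then every monotone dynamo on $G$ under reversible $r$-bootstrap percolation has at least $2\big(1-\frac{\Delta}{2r}\big)|V(G)|$ active vertices; i.e. $\overleftarrow{m}_{mon}(G,r)\ge 2\big(1-\frac{\Delta}{2r}\big)|G|$.
   Context: A configuration assigns each vertex a state active (1) or inactive (0); its size is the number of active vertices. In reversible $r$-bootstrap percolation, in each round, simultaneously, every vertex becomes active if it has at least $r$ active neighbors and inactive otherwise. A dynamo is an initial configuration $\omega^{(0)}$ such that from some time on all vertices are active forever; it is monotone if moreover $\omega^{(t+1)}\ge\omega^{(t)}$ coordinatewise for all $t\ge0$. $\overleftarrow{m}_{mon}(G,r)$ is the minimum size of a monotone dynamo under reversible $r$-bootstrap percolation on $G$, and $|G|$ is the number of vertices of $G$. -}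

module Defs where

open import Data.Nat using (ℕ; zero; suc; _+_; _*_; _≤_; _≥_)
open import Data.Bool using (Bool; true; false; if_then_else_)
open import Data.Fin using (Fin)
open import Data.List using (List; filter; length; allFin)
open import Data.Product using (_×_; ∃-syntax)
open import Relation.Binary.PropositionalEquality using (_≡_)
open import Data.Bool.Properties using (T?)
open import Data.Bool using () renaming (_≤_ to _≤ᵇ_)
open import Data.Nat using () renaming (_≤ᵇ_ to _≤ℕᵇ_)

record Graph (n : ℕ) : Set where
  field
    adj       : Fin n → Fin n → Bool
    symmetric : ∀ u v → adj u v ≡ adj v u
    irrefl    : ∀ v → adj v v ≡ false
open Graph public

count : {n : ℕ} → (Fin n → Bool) → ℕ
count {n} p = length (filter (λ v → T? (p v)) (allFin n))

degree : {n : ℕ} → Graph n → Fin n → ℕ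
degree G v = count (adj G v)

Regular : {n : ℕ} → Graph n → ℕ → Set
Regular G Δ = ∀ v → degree G v ≡ Δ

-- configurations: true = active, false = inactive
Config : ℕ → Set
Config n = Fin n → Bool

size : {n : ℕ} → Config n → ℕ
size ω = count ω

activeNbrs : {n : ℕ} → Graph n → Config n → Fin n → ℕ
activeNbrs G ω v = count (λ w → if adj G v w then ω w else false)

step : {n : ℕ} → Graph n → ℕ → Config n → Config n
step G r ω v = r ≤ℕᵇ activeNbrs G ω v

evolve : {n : ℕ} → Graph n → ℕ → Config n → ℕ → Config n
evolve G r ω zero    = ω
evolve G r ω (suc t) = step G r (evolve G r ω t)

Dynamo : {n : ℕ} → Graph n → ℕ → Config n → Set
Dynamo G r ω = ∃[ T₀ ] ∀ t → T₀ ≤ t → ∀ v → evolve G r ω t v ≡ true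

MonotoneDynamo : {n : ℕ} → Graph n → ℕ → Config n → Set
MonotoneDynamo G r ω =
  Dynamo G r ω × (∀ t v → evolve G r ω t v ≤ᵇ evolve G r ω (suc t) v)

-- Order the vertices by their activation time τ. In a monotone dynamo a vertex v is
-- still active at time τ v + 1, so at least r of its Δ neighbours u have τ u ≤ τ v;
-- an initially inactive v was switched on at time τ v by r neighbours active one step
-- earlier, so at least r neighbours have τ u < τ v. Summed over v, the pairs of
-- neighbours with τ u < τ v are as many as those with τ v < τ u, and the latter number
-- at most (Δ − r) n. Hence r (n − |ω|) ≤ (Δ − r) n.
module Submission where

open import Defs
open import Data.Nat using (ℕ; zero; suc; _+_; _*_; _≤_; _<ᵇ_; z≤n; s≤s)
open import Data.Nat.Properties
  using ( +-*-semiring; ≤-refl; ≤-reflexive; ≤-trans; +-mono-≤; +-monoʳ-≤; +-comm; +-assoc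
        ; +-identityʳ; *-assoc; *-identityˡ; *-identityʳ; *-zeroʳ; *-suc; *-distribˡ-+
        ; ≤ᵇ⇒≤; <⇒<ᵇ; module ≤-Reasoning)
open import Data.Bool using (Bool; true; false; not; _∧_; T; if_then_else_)
open import Data.Bool using (b≤b) renaming (_≤_ to _≤ᵇ_)
open import Data.Bool.Properties using (T?; T-≡; T-not-≡)
open import Data.Empty using (⊥-elim)
open import Data.Fin using (Fin)
import Data.Fin as Fin
open import Data.List using (filter; length; tabulate)
open import Data.Product using (proj₁; proj₂)
open import Function using (_∘_; id; Equivalence)
open import Relation.Binary.PropositionalEquality using (_≡_; refl; sym; trans; cong; cong₂; subst; module ≡-Reasoning)
open import Algebra.Properties.Semiring.Sum +-*-semiring
  using (sum; sum-syntax; sum-cong-≗; ∑-distrib-+; ∑-comm; *-distribˡ-sum)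

T-mono : ∀ {a b} → a ≤ᵇ b → T a → T b
T-mono b≤b a = a

not-<ᵇ-suc : ∀ m n → not (m <ᵇ suc n) ≡ (n <ᵇ m)
not-<ᵇ-suc zero    n       = refl
not-<ᵇ-suc (suc m) zero    = refl
not-<ᵇ-suc (suc m) (suc n) = not-<ᵇ-suc m n

sum-mono-≤ : ∀ {n} {f g : Fin n → ℕ} → (∀ i → f i ≤ g i) → sum f ≤ sum g
sum-mono-≤ {zero}  _   = z≤n
sum-mono-≤ {suc n} f≤g = +-mono-≤ (f≤g Fin.zero) (sum-mono-≤ (f≤g ∘ Fin.suc))

∑-const : ∀ n c → ∑[ _ < n ] c ≡ c * n
∑-const zero    c = sym (*-zeroʳ c)
∑-const (suc n) c = trans (cong (c +_) (∑-const n c)) (sym (*-suc c n))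

indicator : Bool → ℕ
indicator b = if b then 1 else 0

length-filter-tabulate : ∀ {m n} (p : Fin n → Bool) (f : Fin m → Fin n) →
  length (filter (T? ∘ p) (tabulate f)) ≡ ∑[ i < m ] indicator (p (f i))
length-filter-tabulate {zero}  p f = refl
length-filter-tabulate {suc m} p f with p (f Fin.zero)
... | true  = cong suc (length-filter-tabulate p (f ∘ Fin.suc))
... | false = length-filter-tabulate p (f ∘ Fin.suc)

count≡∑ : ∀ {n} (p : Fin n → Bool) → count p ≡ ∑[ v < n ] indicator (p v)
count≡∑ p = length-filter-tabulate p id

count-cong : ∀ {n} {p q : Fin n → Bool} → (∀ v → p v ≡ q v) → count p ≡ count q
count-cong {p = p} {q} p≗q =
  trans (count≡∑ p) (trans (sum-cong-≗ (cong indicator ∘ p≗q)) (sym (count≡∑ q)))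

count-true : ∀ n → count {n} (λ _ → true) ≡ n
count-true n = trans (count≡∑ {n} (λ _ → true)) (trans (∑-const n 1) (*-identityˡ n))

count-split : ∀ {n} (p q : Fin n → Bool) →
  count p ≡ count (λ v → p v ∧ q v) + count (λ v → p v ∧ not (q v))
count-split {n} p q = begin
  count p                                                        ≡⟨ count≡∑ p ⟩
  sum (indicator ∘ p)                                            ≡⟨ sum-cong-≗ split ⟩
  sum (λ v → indicator (p∧q v) + indicator (p∧¬q v))             ≡⟨ ∑-distrib-+ (indicator ∘ p∧q) (indicator ∘ p∧¬q) ⟩
  sum (indicator ∘ p∧q) + sum (indicator ∘ p∧¬q)                 ≡⟨ cong₂ _+_ (count≡∑ p∧q) (count≡∑ p∧¬q) ⟨
  count p∧q + count p∧¬q                                         ∎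
  where
  open ≡-Reasoning
  p∧q p∧¬q : Fin n → Bool
  p∧q v  = p v ∧ q v
  p∧¬q v = p v ∧ not (q v)
  split : ∀ v → indicator (p v) ≡ indicator (p∧q v) + indicator (p∧¬q v)
  split v with p v | q v
  ... | false | _     = refl
  ... | true  | true  = refl
  ... | true  | false = refl

count-mono : ∀ {n} {p q : Fin n → Bool} → (∀ v → T (p v) → T (q v)) → count p ≤ count q
count-mono {p = p} {q} p⇒q = begin
  count p               ≡⟨ count≡∑ p ⟩
  sum (indicator ∘ p)   ≤⟨ sum-mono-≤ (λ v → indicator-mono (p⇒q v)) ⟩
  sum (indicator ∘ q)   ≡⟨ count≡∑ q ⟨
  count q               ∎
  where
  open ≤-Reasoning
  indicator-mono : ∀ {a b} → (T a → T b) → indicator a ≤ indicator b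
  indicator-mono {false}         _   = z≤n
  indicator-mono {true}  {true}  _   = ≤-refl
  indicator-mono {true}  {false} a⇒b = ⊥-elim (a⇒b _)

*-count≤∑ : ∀ {n} c (p : Fin n → Bool) {f : Fin n → ℕ} →
  (∀ v → T (p v) → c ≤ f v) → c * count p ≤ ∑[ v < n ] f v
*-count≤∑ c p {f} p⇒c≤f = begin
  c * count p                         ≡⟨ cong (c *_) (count≡∑ p) ⟩
  c * sum (indicator ∘ p)             ≡⟨ *-distribˡ-sum c (indicator ∘ p) ⟩
  sum (λ v → c * indicator (p v))     ≤⟨ sum-mono-≤ (λ v → *-indicator≤ (p v) (p⇒c≤f v)) ⟩
  sum f                               ∎
  where
  open ≤-Reasoning
  *-indicator≤ : ∀ b {m} → (T b → c ≤ m) → c * indicator b ≤ m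
  *-indicator≤ false _   = ≤-trans (≤-reflexive (*-zeroʳ c)) z≤n
  *-indicator≤ true  c≤m = ≤-trans (≤-reflexive (*-identityʳ c)) (c≤m _)

∑-count-adj-flip : ∀ {n} (G : Graph n) (R : Fin n → Fin n → Bool) →
  ∑[ v < n ] count (λ u → adj G v u ∧ R u v) ≡ ∑[ v < n ] count (λ u → adj G v u ∧ R v u)
∑-count-adj-flip {n} G R = begin
  ∑[ v < n ] count (λ u → adj G v u ∧ R u v)
    ≡⟨ sum-cong-≗ (λ v → count≡∑ (λ u → adj G v u ∧ R u v)) ⟩
  ∑[ v < n ] ∑[ u < n ] indicator (adj G v u ∧ R u v)
    ≡⟨ ∑-comm (λ v u → indicator (adj G v u ∧ R u v)) ⟩
  ∑[ u < n ] ∑[ v < n ] indicator (adj G v u ∧ R u v)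
    ≡⟨ sum-cong-≗ (λ u → sum-cong-≗ (λ v → cong (λ a → indicator (a ∧ R u v)) (symmetric G v u))) ⟩
  ∑[ u < n ] ∑[ v < n ] indicator (adj G u v ∧ R u v)
    ≡⟨ sum-cong-≗ (λ u → count≡∑ (λ v → adj G u v ∧ R u v)) ⟨
  ∑[ u < n ] count (λ v → adj G u v ∧ R u v)
    ∎
  where open ≡-Reasoning

-- τ u <ᵇ suc (τ v) expresses τ u ≤ τ v in the form whose negation is τ v <ᵇ τ u.
rankedNeighbours⇒size-bound : ∀ {n Δ} (G : Graph n) → Regular G Δ →
  ∀ r (ω : Config n) (τ : Fin n → ℕ) →
  (∀ v → r ≤ count (λ u → adj G v u ∧ (τ u <ᵇ suc (τ v)))) →
  (∀ v → T (not (ω v)) → r ≤ count (λ u → adj G v u ∧ (τ u <ᵇ τ v))) →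
  2 * r * n ≤ r * size ω + Δ * n
rankedNeighbours⇒size-bound {n} {Δ} G regular r ω τ r≤notLater r≤earlier = begin
  2 * r * n                                        ≡⟨ double ⟩
  r * n + r * n                                    ≡⟨ cong (λ m → r * m + r * n) (sym complement) ⟩
  r * (size ω + inactive) + r * n                  ≡⟨ cong (_+ r * n) (*-distribˡ-+ r (size ω) inactive) ⟩
  r * size ω + r * inactive + r * n                ≡⟨ +-assoc (r * size ω) _ _ ⟩
  r * size ω + (r * inactive + r * n)              ≤⟨ +-monoʳ-≤ (r * size ω) (+-mono-≤ r*inactive≤ r*n≤) ⟩
  r * size ω + (sum earlier + sum notLater)        ≡⟨ cong (λ m → r * size ω + (m + sum notLater)) ∑earlier≡∑later ⟩
  r * size ω + (sum later + sum notLater)          ≡⟨ cong (r * size ω +_) (+-comm (sum later) _) ⟩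
  r * size ω + (sum notLater + sum later)          ≡⟨ cong (r * size ω +_) (∑-distrib-+ notLater later) ⟨
  r * size ω + ∑[ v < n ] (notLater v + later v)   ≡⟨ cong (r * size ω +_) (sum-cong-≗ notLater+later) ⟩
  r * size ω + ∑[ _ < n ] Δ                        ≡⟨ cong (r * size ω +_) (∑-const n Δ) ⟩
  r * size ω + Δ * n                               ∎
  where
  open ≤-Reasoning
  inactive : ℕ
  inactive = count (not ∘ ω)
  earlier later notLater : Fin n → ℕ
  earlier v  = count (λ u → adj G v u ∧ (τ u <ᵇ τ v))
  later v    = count (λ u → adj G v u ∧ (τ v <ᵇ τ u))
  notLater v = count (λ u → adj G v u ∧ (τ u <ᵇ suc (τ v)))

  double : 2 * r * n ≡ r * n + r * n
  double = trans (*-assoc 2 r n) (cong (r * n +_) (+-identityʳ (r * n)))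

  complement : size ω + inactive ≡ n
  complement = trans (sym (count-split (λ _ → true) ω)) (count-true n)

  r*inactive≤ : r * inactive ≤ sum earlier
  r*inactive≤ = *-count≤∑ r (not ∘ ω) r≤earlier

  ∑earlier≡∑later : sum earlier ≡ sum later
  ∑earlier≡∑later = ∑-count-adj-flip G (λ u v → τ u <ᵇ τ v)

  r*n≤ : r * n ≤ sum notLater
  r*n≤ = ≤-trans (≤-reflexive (sym (∑-const n r))) (sum-mono-≤ r≤notLater)

  notLater+later : ∀ v → notLater v + later v ≡ Δ
  notLater+later v = begin-equality
    notLater v + later v
      ≡⟨ cong (notLater v +_) (count-cong (λ u → cong (adj G v u ∧_) (not-<ᵇ-suc (τ u) (τ v)))) ⟨
    notLater v + count (λ u → adj G v u ∧ not (τ u <ᵇ suc (τ v)))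
      ≡⟨ count-split (adj G v) (λ u → τ u <ᵇ suc (τ v)) ⟨
    degree G v
      ≡⟨ regular v ⟩
    Δ ∎

firstTrue : (ℕ → Bool) → ℕ → ℕ
firstTrue f zero    = zero
firstTrue f (suc k) = if f zero then zero else suc (firstTrue (f ∘ suc) k)

firstTrue-true : ∀ (f : ℕ → Bool) k → T (f k) → T (f (firstTrue f k))
firstTrue-true f zero    fk = fk
firstTrue-true f (suc k) fk with f zero in f0
... | true  = subst T (sym f0) _
... | false = firstTrue-true (f ∘ suc) k fk

firstTrue-minimal : ∀ (f : ℕ → Bool) k t → T (f t) → firstTrue f k ≤ t
firstTrue-minimal f zero    t       _  = z≤n
firstTrue-minimal f (suc k) zero    f0 with f zero | f0
... | true  | _  = z≤n
... | false | ()
firstTrue-minimal f (suc k) (suc t) ft with f zero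
... | true  = z≤n
... | false = s≤s (firstTrue-minimal (f ∘ suc) k t ft)

r≤neighboursActivatedBy : ∀ {n} (G : Graph n) r (ω : Config n) (τ : Fin n → ℕ) →
  (∀ t u → T (evolve G r ω t u) → τ u ≤ t) →
  ∀ s v → T (evolve G r ω (suc s) v) → r ≤ count (λ u → adj G v u ∧ (τ u <ᵇ suc s))
r≤neighboursActivatedBy G r ω τ τ-minimal s v active =
  ≤-trans (≤ᵇ⇒≤ r _ active) (count-mono activatedBy)
  where
  activatedBy : ∀ u → T (if adj G v u then evolve G r ω s u else false) →
                T (adj G v u ∧ (τ u <ᵇ suc s))
  activatedBy u with adj G v u
  ... | true  = λ activeᵤ → <⇒<ᵇ (s≤s (τ-minimal s u activeᵤ))
  ... | false = λ ()

module ActivationTime {n} (G : Graph n) (r : ℕ) (ω : Config n) (dynamo : MonotoneDynamo G r ω) where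

  private
    ω[_] : ℕ → Config n
    ω[_] = evolve G r ω

    T₀ : ℕ
    T₀ = proj₁ (proj₁ dynamo)

  τ : Fin n → ℕ
  τ v = firstTrue (λ t → ω[ t ] v) T₀

  active-at-τ : ∀ v → T (ω[ τ v ] v)
  active-at-τ v =
    firstTrue-true (λ t → ω[ t ] v) T₀ (Equivalence.from T-≡ (proj₂ (proj₁ dynamo) T₀ ≤-refl v))

  τ-minimal : ∀ t v → T (ω[ t ] v) → τ v ≤ t
  τ-minimal t v = firstTrue-minimal (λ t → ω[ t ] v) T₀ t

  r≤neighboursNotLater : ∀ v → r ≤ count (λ u → adj G v u ∧ (τ u <ᵇ suc (τ v)))
  r≤neighboursNotLater v =
    r≤neighboursActivatedBy G r ω τ τ-minimal (τ v) v (T-mono (proj₂ dynamo (τ v) v) (active-at-τ v))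

  r≤neighboursEarlier : ∀ v → T (not (ω v)) → r ≤ count (λ u → adj G v u ∧ (τ u <ᵇ τ v))
  r≤neighboursEarlier v inactive = activeAt (τ v) (active-at-τ v)
    where
    activeAt : ∀ t → T (ω[ t ] v) → r ≤ count (λ u → adj G v u ∧ (τ u <ᵇ t))
    activeAt zero    active = ⊥-elim (subst T (Equivalence.to T-not-≡ inactive) active)
    activeAt (suc s) active = r≤neighboursActivatedBy G r ω τ τ-minimal s v active

-- The bound holds for every r.
lemma7 : (n Δ r : ℕ) (G : Graph n) → Regular G Δ → 1 ≤ r → r ≤ Δ →
    (ω : Config n) → MonotoneDynamo G r ω →
    2 * r * n ≤ r * size ω + Δ * n
lemma7 n Δ r G regular _ _ ω dynamo =
  rankedNeighbours⇒size-bound G regular r ω τ r≤neighboursNotLater r≤neighboursEarlier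
  where open ActivationTime G r ω dynamo
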